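{- Let $m,l\ge1$, $\sigma\in S_m$, $\alpha\in S_l$, and suppose there are integers $i_1<\dots<i_s<a$ with $a+1\le m$ and an integer $b$ such that $\operatorname{RLmax}\sigma=\{i_1,\dots,i_s,a\}\cup[a+1,m]$ and $\operatorname{RLmax}\alpha=[b-a,l]$. Let $\sigma'=\sigma(\alpha,a+1)$ and assume $\operatorname{Stp}\sigma\subseteq\{a\}$. Then $a+l$ is the largest index $k$ such that the set $\{\sigma'_{a+1},\dots,\sigma'_k\}$ is an interval of integers. Consequently, $\alpha$ and $\sigma$ are uniquely determined by $\sigma'$ and $a$.
   Context: $[x,y]=\{x,\dots,y\}$. $\operatorname{Stp}\pi=\{i:\pi_i-1=\pi_{i+1}\}$ (steps). $\operatorname{RLmax}\pi$ is the set of indices $i$ with $\pi_i>\pi_j$ for all $j>i$. Inflation: for $\sigma\in S_m$, $\alpha\in S_l$ and $1\le a+1\le m$, $\sigma(\alpha,a+1)$ is the permutation of length $l+m-1$ given by $\hat\sigma_1\ldots\hat\sigma_a\,\hat\alpha_1\ldots\hat\alpha_l\,\hat\sigma_{a+2}\ldots\hat\sigma_m$, where $\hat\alpha_i=\alpha_i+\sigma_{a+1}-1$, and $\hat\sigma_i=\sigma_i$ if $\sigma_i<\sigma_{a+1}$, $\hat\sigma_i=\sigma_i+l-1$ otherwise. -}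

module Defs where

open import Data.Nat using (ℕ; zero; suc; _+_; _∸_; _≤_; _<_; _<ᵇ_)
open import Data.Integer as ℤ using (ℤ; +_)
open import Data.Bool using (if_then_else_)
open import Data.List using (List; []; _∷_; length; map; take; drop; upTo; _++_)
open import Data.List.Membership.Propositional using (_∈_)
open import Data.List.Relation.Unary.All using (All)
open import Data.List.Relation.Unary.Linked using (Linked)
open import Data.List.Relation.Binary.Permutation.Propositional using (_↭_)
open import Data.Product using (Σ; _×_)
open import Data.Sum using (_⊎_)
open import Relation.Binary.PropositionalEquality using (_≡_)
open import Relation.Nullary using (¬_)

_⟺_ : Set → Set → Set
A ⟺ B = (A → B) × (B → A)
infix 3 _⟺_

oneTo : ℕ → List ℕ
oneTo n = map suc (upTo n)

-- S n : permutations of [1,n] in one-line notation π₁…πₙ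
S : ℕ → Set
S n = Σ (List ℕ) (λ w → w ↭ oneTo n)

-- 1-based entry π_i (0 outside [1, length])
at : List ℕ → ℕ → ℕ
at []      _             = 0
at (x ∷ w) zero          = 0
at (x ∷ w) (suc zero)    = x
at (x ∷ w) (suc (suc i)) = at w (suc i)

IsRLmax : List ℕ → ℕ → Set
IsRLmax w i = (1 ≤ i) × (i ≤ length w) ×
  (∀ j → i < j → j ≤ length w → at w j < at w i)

InRLmax : List ℕ → ℤ → Set
InRLmax w x = Σ ℕ (λ i → (x ≡ + i) × IsRLmax w i)

IsStep : List ℕ → ℕ → Set
IsStep w i = (1 ≤ i) × (suc i ≤ length w) × (at w i ∸ 1 ≡ at w (suc i))

-- inflation σ(α, a+1)
inflate : List ℕ → List ℕ → ℕ → List ℕ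
inflate σ α a =
  map hatσ (take a σ) ++ map hatα α ++ map hatσ (drop (suc a) σ)
  where
    l = length α
    v = at σ (suc a)
    hatσ : ℕ → ℕ
    hatσ x = if x <ᵇ v then x else x + l ∸ 1
    hatα : ℕ → ℕ
    hatα y = y + v ∸ 1

InSeg : List ℕ → ℕ → ℕ → ℕ → Set
InSeg w i k x = Σ ℕ (λ j → (i ≤ j) × (j ≤ k) × (at w j ≡ x))

SegIsInterval : List ℕ → ℕ → ℕ → Set
SegIsInterval w i k =
  Σ ℤ (λ p → Σ ℤ (λ q → ∀ (x : ℤ) →
    (Σ ℕ (λ y → (x ≡ + y) × InSeg w i k y)) ⟺ ((p ℤ.≤ x) × (x ℤ.≤ q))))

Hyp : (m l : ℕ) → List ℕ → List ℕ → ℕ → Set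
Hyp m l σ α a =
  (suc a ≤ m) ×
  Σ (List ℤ) (λ is → Linked ℤ._<_ is × All (ℤ._< + a) is ×
    (∀ (x : ℤ) → InRLmax σ x ⟺
       ((x ∈ is) ⊎ (x ≡ + a) ⊎ ((+ suc a ℤ.≤ x) × (x ℤ.≤ + m))))) ×
  Σ ℤ (λ b → ∀ (x : ℤ) → InRLmax α x ⟺ ((b ℤ.- + a ℤ.≤ x) × (x ℤ.≤ + l))) ×
  (∀ i → IsStep σ i → i ≡ a)

-- Write v = σ_{a+1}. In σ' = σ(α, a+1) the block α̂ occupies the positions a+1, …, a+l and
-- its values are exactly the interval [v, v+l-1]. Since a+1 and a+2 are right-to-left maxima
-- of σ and a+1 is not a step, every entry of σ after position a+1 is below v-1, so it is
-- left unchanged by the hat. Extending the segment beyond a+l therefore adds a value below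
-- v-1 while v-1 itself never occurs: a gap. Hence l is read off σ', which splits σ' into its
-- three blocks; the pivot v is the least value of the middle block, and σ and α are
-- recovered from the blocks because both hats are injective.
module Submission where

open import Defs
open import Data.Nat
open import Data.Nat.Properties
open import Data.Bool using (true; false; T; if_then_else_)
open import Data.Unit using (tt)
open import Data.Integer as ℤ using (+_; -[1+_]; +≤+)
import Data.Integer.Properties as ℤ
open import Data.List using (List; []; _∷_; length; map; take; drop; upTo; _++_)
open import Data.List.Properties
  using (length-map; length-++; length-take; length-upTo; map-injective; take++drop≡id; drop-all;
         ++-identityʳ; ∷-injective)
open import Data.List.Membership.Propositional using (_∈_)
open import Data.List.Membership.Propositional.Properties
  using (∈-map⁺; ∈-map⁻; ∈-++⁻; ∈-upTo⁺; ∈-upTo⁻)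
open import Data.List.Relation.Unary.All as All using (All; []; _∷_)
import Data.List.Relation.Unary.All.Properties as All
open import Data.List.Relation.Unary.Any using (here; there)
open import Data.List.Relation.Binary.Permutation.Propositional using (_↭_; ↭-sym)
open import Data.List.Relation.Binary.Permutation.Propositional.Properties
  using (∈-resp-↭; ↭-length)
open import Data.Product using (Σ; ∃; _×_; _,_; proj₁; proj₂)
open import Data.Sum using (_⊎_; inj₁; inj₂)
open import Data.Empty using (⊥-elim)
open import Function.Definitions using (Injective)
open import Relation.Binary using (tri<; tri≈; tri>)
open import Relation.Binary.PropositionalEquality
open import Relation.Nullary using (¬_; yes; no)

private
  suc+-cancelˡ-≤ : ∀ n {t m} → suc (n + t) ≤ n + m → suc t ≤ m
  suc+-cancelˡ-≤ n {t} {m} h = +-cancelˡ-≤ n _ _ (subst (_≤ n + m) (sym (+-suc n t)) h)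

  low≢high : ∀ {x v y} L → x < v → v ≤ y → x ≢ y + L
  low≢high {y = y} L x<v v≤y x≡y+L =
    <⇒≱ x<v (≤-trans v≤y (≤-trans (m≤m+n y L) (≤-reflexive (sym x≡y+L))))

at-++ˡ : ∀ (P Q : List ℕ) {j} → suc j ≤ length P → at (P ++ Q) (suc j) ≡ at P (suc j)
at-++ˡ (x ∷ P) Q {zero}  _         = refl
at-++ˡ (x ∷ P) Q {suc j} (s≤s j<P) = at-++ˡ P Q j<P

at-++ʳ : ∀ (P Q : List ℕ) j → at (P ++ Q) (suc (length P + j)) ≡ at Q (suc j)
at-++ʳ []      Q j = refl
at-++ʳ (x ∷ P) Q j = at-++ʳ P Q j

at-++-∷ : ∀ (P : List ℕ) x Q → at (P ++ x ∷ Q) (suc (length P)) ≡ x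
at-++-∷ []      x Q = refl
at-++-∷ (y ∷ P) x Q = at-++-∷ P x Q

at-drop : ∀ n (w : List ℕ) j → at (drop n w) (suc j) ≡ at w (suc (n + j))
at-drop zero    w       j = refl
at-drop (suc n) []      j = refl
at-drop (suc n) (x ∷ w) j = at-drop n w j

length-drop-< : ∀ n (w : List ℕ) {t} → suc t ≤ length (drop n w) → suc (n + t) ≤ length w
length-drop-< zero    w       t<  = t<
length-drop-< (suc n) (x ∷ w) t<  = s≤s (length-drop-< n w t<)

drop-at : ∀ n (w : List ℕ) → suc n ≤ length w → drop n w ≡ at w (suc n) ∷ drop (suc n) w
drop-at zero    (x ∷ w) _         = refl
drop-at (suc n) (x ∷ w) (s≤s n<w) = drop-at n w n<w

length-map-take≤ : ∀ (f : ℕ → ℕ) n (xs : List ℕ) → n ≤ length xs → length (map f (take n xs)) ≡ n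
length-map-take≤ f n xs n≤xs =
  trans (length-map f (take n xs)) (trans (length-take n xs) (m≤n⇒m⊓n≡m n≤xs))

take-at-drop : ∀ n (w : List ℕ) → suc n ≤ length w → take n w ++ at w (suc n) ∷ drop (suc n) w ≡ w
take-at-drop n w n<w = trans (cong (take n w ++_) (sym (drop-at n w n<w))) (take++drop≡id n w)

at-∈ : ∀ (w : List ℕ) {t} → suc t ≤ length w → at w (suc t) ∈ w
at-∈ (x ∷ w) {zero}  _         = here refl
at-∈ (x ∷ w) {suc t} (s≤s t<w) = there (at-∈ w t<w)

∈⇒at : ∀ {x} (w : List ℕ) → x ∈ w → ∃ λ t → suc t ≤ length w × at w (suc t) ≡ x
∈⇒at (y ∷ w) (here refl) = zero , s≤s z≤n , refl
∈⇒at (y ∷ w) (there x∈w) with t , t<w , eq ← ∈⇒at w x∈w = suc t , s≤s t<w , eq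

All-at : ∀ {P : ℕ → Set} (w : List ℕ) → (∀ t → suc t ≤ length w → P (at w (suc t))) → All P w
All-at []      _ = []
All-at (x ∷ w) f = f zero (s≤s z≤n) ∷ All-at w (λ t t<w → f (suc t) (s≤s t<w))

++-injective : ∀ (xs ys us ws : List ℕ) → length xs ≡ length ys → xs ++ us ≡ ys ++ ws →
  xs ≡ ys × us ≡ ws
++-injective []       []       us ws _   eq = refl , eq
++-injective (x ∷ xs) (y ∷ ys) us ws len eq
  with x≡y , eq′ ← ∷-injective eq
  with xs≡ys , us≡ws ← ++-injective xs ys us ws (suc-injective len) eq′
  = cong₂ _∷_ x≡y xs≡ys , us≡ws

∈-oneTo⁻ : ∀ {x} n → x ∈ oneTo n → 1 ≤ x × x ≤ n
∈-oneTo⁻ n x∈ with y , y∈ , refl ← ∈-map⁻ suc x∈ = s≤s z≤n , ∈-upTo⁻ y∈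

∈-oneTo⁺ : ∀ {x} n → 1 ≤ x → x ≤ n → x ∈ oneTo n
∈-oneTo⁺ {suc x} n _ x<n = ∈-map⁺ suc (∈-upTo⁺ x<n)

∈-↭-oneTo⁻ : ∀ {x n} {w : List ℕ} → w ↭ oneTo n → x ∈ w → 1 ≤ x × x ≤ n
∈-↭-oneTo⁻ {n = n} w↭ x∈w = ∈-oneTo⁻ n (∈-resp-↭ w↭ x∈w)

length-↭-oneTo : ∀ {n} {w : List ℕ} → w ↭ oneTo n → length w ≡ n
length-↭-oneTo {n} w↭ = trans (↭-length w↭) (trans (length-map suc (upTo n)) (length-upTo n))

1∈-↭-oneTo : ∀ {n} {w : List ℕ} → w ↭ oneTo n → 1 ≤ n → 1 ∈ w
1∈-↭-oneTo {n} w↭ 1≤n = ∈-resp-↭ (↭-sym w↭) (∈-oneTo⁺ n ≤-refl 1≤n)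

at-↭-oneTo-positive : ∀ {n} {w : List ℕ} → w ↭ oneTo n → ∀ {t} → suc t ≤ length w →
  1 ≤ at w (suc t)
at-↭-oneTo-positive w↭ t<w = proj₁ (∈-↭-oneTo⁻ w↭ (at-∈ _ t<w))

IsRLmax⇒drop-below : ∀ (w : List ℕ) i → IsRLmax w (suc i) → All (_< at w (suc i)) (drop (suc i) w)
IsRLmax⇒drop-below w i (_ , _ , isMax) = All-at (drop (suc i) w) λ t t< →
  subst (_< at w (suc i)) (sym (at-drop (suc i) w t))
    (isMax (suc (suc i + t)) (s≤s (m≤m+n (suc i) t)) (length-drop-< (suc i) w t<))

-- The maps σ̂ and α̂ of `inflate`, with v = σ_{a+1} and l = |α|: `inflate σ α a` unfolds
-- definitionally to the concatenation of their images.
hatσ : ℕ → ℕ → ℕ → ℕ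
hatσ v l x = if x <ᵇ v then x else x + l ∸ 1

hatα : ℕ → ℕ → ℕ
hatα v y = y + v ∸ 1

hatσ-below : ∀ v l {x} → x < v → hatσ v l x ≡ x
hatσ-below v l {x} x<v with x <ᵇ v | <⇒<ᵇ x<v
... | true | _ = refl

hatσ-cases : ∀ v L x → (x < v × hatσ v (suc L) x ≡ x) ⊎ (v ≤ x × hatσ v (suc L) x ≡ x + L)
hatσ-cases v L x with x <ᵇ v in x<ᵇv
... | true  = inj₁ (<ᵇ⇒< x v (subst T (sym x<ᵇv) tt) , refl)
... | false = inj₂ (≮⇒≥ (λ x<v → subst T x<ᵇv (<⇒<ᵇ x<v)) , cong (_∸ 1) (+-suc x L))

hatσ-injective : ∀ v l → 1 ≤ l → Injective _≡_ _≡_ (hatσ v l)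
hatσ-injective v (suc L) _ {x} {y} eq with hatσ-cases v L x | hatσ-cases v L y
... | inj₁ (_ , ex)   | inj₁ (_ , ey)   = trans (sym ex) (trans eq ey)
... | inj₁ (x<v , ex) | inj₂ (v≤y , ey) = ⊥-elim (low≢high L x<v v≤y (trans (sym ex) (trans eq ey)))
... | inj₂ (v≤x , ex) | inj₁ (y<v , ey) = ⊥-elim (low≢high L y<v v≤x (trans (sym ey) (trans (sym eq) ex)))
... | inj₂ (_ , ex)   | inj₂ (_ , ey)   = +-cancelʳ-≡ L x y (trans (sym ex) (trans eq ey))

hatα-suc : ∀ v₀ y → hatα (suc v₀) y ≡ y + v₀
hatα-suc v₀ y = cong (_∸ 1) (+-suc y v₀)

hatα-injective : ∀ v → 1 ≤ v → Injective _≡_ _≡_ (hatα v)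
hatα-injective (suc v₀) _ {x} {y} eq =
  +-cancelʳ-≡ v₀ x y (trans (sym (hatα-suc v₀ x)) (trans eq (hatα-suc v₀ y)))

∈-map-hatα : ∀ {l v y} {α : List ℕ} → α ↭ oneTo l → 1 ≤ v →
  y ∈ map (hatα v) α ⟺ (v ≤ y × y ≤ l + (v ∸ 1))
∈-map-hatα {l} {suc v₀} {y} {α} α↭ _ = to , from
  where
  to : y ∈ map (hatα (suc v₀)) α → suc v₀ ≤ y × y ≤ l + v₀
  to y∈ with x , x∈α , refl ← ∈-map⁻ (hatα (suc v₀)) y∈ with 1≤x , x≤l ← ∈-↭-oneTo⁻ α↭ x∈α
    rewrite hatα-suc v₀ x = +-monoˡ-≤ v₀ 1≤x , +-monoˡ-≤ v₀ x≤l
  from : suc v₀ ≤ y × y ≤ l + v₀ → y ∈ map (hatα (suc v₀)) α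
  from (v≤y , y≤) = subst (_∈ map (hatα (suc v₀)) α) (trans (hatα-suc v₀ x) (m∸n+n≡m (<⇒≤ v≤y)))
    (∈-map⁺ (hatα (suc v₀)) (∈-resp-↭ (↭-sym α↭) (∈-oneTo⁺ l 1≤x x≤l)))
    where
    x = y ∸ v₀
    1≤x : 1 ≤ x
    1≤x = subst (_≤ x) (m+n∸n≡m 1 v₀) (∸-monoˡ-≤ v₀ v≤y)
    x≤l : x ≤ l
    x≤l = subst (x ≤_) (m+n∸n≡m l v₀) (∸-monoˡ-≤ v₀ y≤)

-- v′ = hatα v′ 1 occurs in the block map (hatα v) α, whose least value is v.
map-hatα-pivot-≤ : ∀ {l l′ v v′} {α β : List ℕ} → α ↭ oneTo l → β ↭ oneTo l′ → 1 ≤ l′ →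
  map (hatα v′) β ≡ map (hatα v) α → v ≤ v′
map-hatα-pivot-≤ {v = v} {v′} α↭ β↭ 1≤l′ eq
  with x , x∈α , v′≡ ← ∈-map⁻ (hatα v) (subst (v′ ∈_) eq (∈-map⁺ (hatα v′) (1∈-↭-oneTo β↭ 1≤l′)))
  = subst (v ≤_) (sym v′≡) (∸-monoˡ-≤ 1 (+-monoˡ-≤ v (proj₁ (∈-↭-oneTo⁻ α↭ x∈α))))

InSeg-mono : ∀ {w i k k′ y} → k ≤ k′ → InSeg w i k y → InSeg w i k′ y
InSeg-mono k≤k′ (j , i≤j , j≤k , eq) = j , i≤j , ≤-trans j≤k k≤k′ , eq

InSeg-++⁺ : ∀ (P Q : List ℕ) {k} t → suc (length P + t) ≤ k →
  InSeg (P ++ Q) (suc (length P)) k (at Q (suc t))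
InSeg-++⁺ P Q t j≤k = suc (length P + t) , s≤s (m≤m+n (length P) t) , j≤k , at-++ʳ P Q t

InSeg-++⁻ : ∀ (P Q : List ℕ) {k y} → InSeg (P ++ Q) (suc (length P)) k y →
  ∃ λ t → suc (length P + t) ≤ k × at Q (suc t) ≡ y
InSeg-++⁻ P Q (j , P<j , j≤k , eq) = j ∸ suc (length P) , subst (_≤ _) (sym j≡) j≤k ,
  trans (sym (at-++ʳ P Q (j ∸ suc (length P)))) (trans (cong (at (P ++ Q)) j≡) eq)
  where
  j≡ : suc (length P + (j ∸ suc (length P))) ≡ j
  j≡ = m+[n∸m]≡n P<j

InSeg-++-∈ : ∀ (P Q : List ℕ) {k y} → k ≤ length (P ++ Q) → InSeg (P ++ Q) (suc (length P)) k y → y ∈ Q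
InSeg-++-∈ P Q k≤ seg with t , j≤k , eq ← InSeg-++⁻ P Q seg =
  subst (_∈ Q) eq (at-∈ Q (suc+-cancelˡ-≤ (length P) (≤-trans j≤k (subst (_ ≤_) (length-++ P) k≤))))

InSeg-block⇔∈ : ∀ (P B R : List ℕ) {y} →
  InSeg (P ++ B ++ R) (suc (length P)) (length P + length B) y ⟺ y ∈ B
InSeg-block⇔∈ P B R {y} = to , from
  where
  to : InSeg (P ++ B ++ R) (suc (length P)) (length P + length B) y → y ∈ B
  to seg with t , j≤k , eq ← InSeg-++⁻ P (B ++ R) seg =
    subst (_∈ B) (trans (sym (at-++ˡ B R t<B)) eq) (at-∈ B t<B)
    where t<B = suc+-cancelˡ-≤ (length P) j≤k
  from : y ∈ B → InSeg (P ++ B ++ R) (suc (length P)) (length P + length B) y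
  from y∈B with t , t<B , eq ← ∈⇒at B y∈B =
    subst (InSeg (P ++ B ++ R) (suc (length P)) (length P + length B)) (trans (at-++ˡ B R t<B) eq)
      (InSeg-++⁺ P (B ++ R) t (subst (_≤ length P + length B) (+-suc (length P) t) (+-monoʳ-≤ (length P) t<B)))

SegIsInterval-fromℕ : ∀ {w i k} p q → (∀ y → InSeg w i k y ⟺ (p ≤ y × y ≤ q)) → SegIsInterval w i k
SegIsInterval-fromℕ {w} {i} {k} p q seg⇔ = + p , + q , λ x → to x , from x
  where
  to : ∀ x → Σ ℕ (λ y → (x ≡ + y) × InSeg w i k y) → (+ p ℤ.≤ x) × (x ℤ.≤ + q)
  to _ (y , refl , seg) with p≤y , y≤q ← proj₁ (seg⇔ y) seg = +≤+ p≤y , +≤+ y≤q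
  from : ∀ x → (+ p ℤ.≤ x) × (x ℤ.≤ + q) → Σ ℕ (λ y → (x ≡ + y) × InSeg w i k y)
  from (+ y)    (+≤+ p≤y , +≤+ y≤q) = y , refl , proj₂ (seg⇔ y) (p≤y , y≤q)
  from -[1+ _ ] (() , _)

SegIsInterval-gap : ∀ {w i k x y z} → InSeg w i k x → InSeg w i k z → x < y → y < z →
  ¬ InSeg w i k y → ¬ SegIsInterval w i k
SegIsInterval-gap {w} {i} {k} {x} {y} {z} seg-x seg-z x<y y<z ¬seg-y (p , q , seg⇔) =
  ¬seg-y (fromℤ (proj₂ (seg⇔ (+ y)) (p≤y , y≤q)))
  where
  fromℤ : Σ ℕ (λ y′ → (+ y ≡ + y′) × InSeg w i k y′) → InSeg w i k y
  fromℤ (_ , refl , seg) = seg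
  p≤y : p ℤ.≤ + y
  p≤y = ℤ.≤-trans (proj₁ (proj₁ (seg⇔ (+ x)) (x , refl , seg-x))) (+≤+ (<⇒≤ x<y))
  y≤q : + y ℤ.≤ q
  y≤q = ℤ.≤-trans (+≤+ (<⇒≤ y<z)) (proj₂ (proj₁ (seg⇔ (+ z)) (z , refl , seg-z)))

IsMaximalIntervalSeg : List ℕ → ℕ → ℕ → Set
IsMaximalIntervalSeg w i k =
  SegIsInterval w i k × (∀ k′ → k < k′ → k′ ≤ length w → ¬ SegIsInterval w i k′)

IsMaximalIntervalSeg-unique : ∀ {w i k k′} → k ≤ length w → k′ ≤ length w →
  IsMaximalIntervalSeg w i k → IsMaximalIntervalSeg w i k′ → k ≡ k′
IsMaximalIntervalSeg-unique {k = k} {k′} k≤w k′≤w (int , max) (int′ , max′) with <-cmp k k′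
... | tri< k<k′ _ _ = ⊥-elim (max k′ k<k′ k′≤w int′)
... | tri≈ _ k≡k′ _ = k≡k′
... | tri> _ _ k′<k = ⊥-elim (max′ k k′<k k≤w int)

block-seg⇔ : ∀ (P B R : List ℕ) {v l y} → length B ≡ l →
  (∀ y → y ∈ B ⟺ (v ≤ y × y ≤ l + (v ∸ 1))) →
  InSeg (P ++ B ++ R) (suc (length P)) (length P + l) y ⟺ (v ≤ y × y ≤ l + (v ∸ 1))
block-seg⇔ P B R {y = y} refl B⇔ =
    (λ seg → proj₁ (B⇔ y) (proj₁ (InSeg-block⇔∈ P B R) seg))
  , (λ bounds → proj₂ (InSeg-block⇔∈ P B R) (proj₂ (B⇔ y) bounds))

block-beyond-¬SegIsInterval : ∀ (P B R : List ℕ) {v l k} → 1 ≤ v → 1 ≤ l → length B ≡ l →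
  (∀ y → y ∈ B ⟺ (v ≤ y × y ≤ l + (v ∸ 1))) → All (_< v ∸ 1) R →
  length P + l < k → k ≤ length (P ++ B ++ R) → ¬ SegIsInterval (P ++ B ++ R) (suc (length P)) k
block-beyond-¬SegIsInterval P B [] {k = k} _ _ refl _ _ n+l<k k≤w =
  ⊥-elim (<⇒≱ n+l<k (subst (k ≤_) w≡n+l k≤w))
  where
  w≡n+l : length (P ++ B ++ []) ≡ length P + length B
  w≡n+l = trans (length-++ P) (cong (λ C → length P + length C) (++-identityʳ B))
block-beyond-¬SegIsInterval P B (r ∷ R) {suc v₀} {l} {k} _ 1≤l refl B⇔ (r<v₀ ∷ R<v₀) n+l<k k≤w =
  SegIsInterval-gap {w} {y = v₀} seg-r seg-v r<v₀ ≤-refl ¬seg-v₀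
  where
  w = P ++ B ++ r ∷ R
  seg-r : InSeg w (suc (length P)) k r
  seg-r = subst (InSeg w (suc (length P)) k) (at-++-∷ B r R) (InSeg-++⁺ P (B ++ r ∷ R) l n+l<k)
  seg-v : InSeg w (suc (length P)) k (suc v₀)
  seg-v = InSeg-mono {w} (<⇒≤ n+l<k)
    (proj₂ (block-seg⇔ P B (r ∷ R) {v = suc v₀} refl B⇔) (≤-refl , +-monoˡ-≤ v₀ 1≤l))
  ¬seg-v₀ : ¬ InSeg w (suc (length P)) k v₀
  ¬seg-v₀ seg with ∈-++⁻ B (InSeg-++-∈ P (B ++ r ∷ R) k≤w seg)
  ... | inj₁ v₀∈B = 1+n≰n (proj₁ (proj₁ (B⇔ v₀) v₀∈B))
  ... | inj₂ v₀∈R = <-irrefl refl (All.lookup (r<v₀ ∷ R<v₀) v₀∈R)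

block-isMaximalIntervalSeg : ∀ (P B R : List ℕ) {v l} → 1 ≤ v → 1 ≤ l → length B ≡ l →
  (∀ y → y ∈ B ⟺ (v ≤ y × y ≤ l + (v ∸ 1))) → All (_< v ∸ 1) R →
  IsMaximalIntervalSeg (P ++ B ++ R) (suc (length P)) (length P + l)
block-isMaximalIntervalSeg P B R {v} {l} 1≤v 1≤l B≡l B⇔ R<v =
    SegIsInterval-fromℕ {P ++ B ++ R} v (l + (v ∸ 1)) (λ y → block-seg⇔ P B R {y = y} B≡l B⇔)
  , λ k → block-beyond-¬SegIsInterval P B R 1≤v 1≤l B≡l B⇔ R<v

drop-below-pivot : ∀ (σ : List ℕ) a → (∀ i → suc a ≤ i → i ≤ length σ → IsRLmax σ i) →
  ¬ IsStep σ (suc a) → All (_< at σ (suc a) ∸ 1) (drop (suc a) σ)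
drop-below-pivot σ a isRLmax ¬step with suc (suc a) ≤? length σ
... | no a+2≰σ = subst (All _) (sym (drop-all (suc a) σ (≮⇒≥ a+2≰σ))) []
... | yes a+2≤σ rewrite drop-at (suc a) σ a+2≤σ =
  d<v∸1 ∷ All.map (λ x<d → <-trans x<d d<v∸1)
                  (IsRLmax⇒drop-below σ (suc a) (isRLmax (suc (suc a)) (n≤1+n (suc a)) a+2≤σ))
  where
  d<v : at σ (suc (suc a)) < at σ (suc a)
  d<v = proj₂ (proj₂ (isRLmax (suc a) ≤-refl (<⇒≤ a+2≤σ))) (suc (suc a)) ≤-refl a+2≤σ
  d<v∸1 : at σ (suc (suc a)) < at σ (suc a) ∸ 1
  d<v∸1 = ≤∧≢⇒< (<⇒≤pred d<v) (λ d≡v∸1 → ¬step (s≤s z≤n , a+2≤σ , sym d≡v∸1))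

inflate-isMaximalIntervalSeg : ∀ {l} (σ α : List ℕ) a → α ↭ oneTo l → 1 ≤ l → suc a ≤ length σ →
  1 ≤ at σ (suc a) → All (_< at σ (suc a) ∸ 1) (drop (suc a) σ) →
  IsMaximalIntervalSeg (inflate σ α a) (a + 1) (a + l)
inflate-isMaximalIntervalSeg {l} σ α a α↭ 1≤l a<σ 1≤v D<v∸1 =
  subst₂ (IsMaximalIntervalSeg (inflate σ α a)) (trans (cong suc P≡a) (+-comm 1 a)) (cong (_+ l) P≡a)
    (block-isMaximalIntervalSeg P (map (hatα v) α) R 1≤v 1≤l
      (trans (length-map (hatα v) α) (length-↭-oneTo α↭)) (λ _ → ∈-map-hatα α↭ 1≤v) R<v∸1)
  where
  v = at σ (suc a)
  P = map (hatσ v (length α)) (take a σ)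
  R = map (hatσ v (length α)) (drop (suc a) σ)
  P≡a : length P ≡ a
  P≡a = length-map-take≤ _ a σ (<⇒≤ a<σ)
  R<v∸1 : All (_< v ∸ 1) R
  R<v∸1 = All.map⁺ (All.map (λ {x} x<v∸1 →
    subst (_< v ∸ 1) (sym (hatσ-below v (length α) (<-≤-trans x<v∸1 (m∸n≤m v 1)))) x<v∸1) D<v∸1)

a+l≤length-inflate : ∀ {l} (σ α : List ℕ) a → α ↭ oneTo l → a ≤ length σ →
  a + l ≤ length (inflate σ α a)
a+l≤length-inflate {l} σ α a α↭ a≤σ = begin
  a + l                        ≡⟨ cong₂ _+_ P≡a B≡l ⟨
  length P + length B          ≤⟨ +-monoʳ-≤ (length P) (m≤m+n (length B) (length R)) ⟩
  length P + (length B + length R) ≡⟨ cong (_+_ (length P)) (length-++ B) ⟨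
  length P + length (B ++ R)   ≡⟨ length-++ P ⟨
  length (P ++ B ++ R)         ∎
  where
  open ≤-Reasoning
  v = at σ (suc a)
  P = map (hatσ v (length α)) (take a σ)
  B = map (hatα v) α
  R = map (hatσ v (length α)) (drop (suc a) σ)
  P≡a : length P ≡ a
  P≡a = length-map-take≤ _ a σ a≤σ
  B≡l : length B ≡ l
  B≡l = trans (length-map _ α) (length-↭-oneTo α↭)

inflate-injective : ∀ {l} (σ τ α β : List ℕ) a → α ↭ oneTo l → β ↭ oneTo l → 1 ≤ l →
  suc a ≤ length σ → suc a ≤ length τ → 1 ≤ at σ (suc a) →
  inflate τ β a ≡ inflate σ α a → τ ≡ σ × β ≡ α
inflate-injective σ τ α β a α↭ β↭ 1≤l a<σ a<τ 1≤v eq = τ≡σ , β≡α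
  where
  v  = at σ (suc a)
  v′ = at τ (suc a)
  L  = length α
  L′ = length β
  split-left = ++-injective (map (hatσ v′ L′) (take a τ)) (map (hatσ v L) (take a σ)) _ _
    (trans (length-map-take≤ _ a τ (<⇒≤ a<τ)) (sym (length-map-take≤ _ a σ (<⇒≤ a<σ)))) eq
  split-right = ++-injective (map (hatα v′) β) (map (hatα v) α) _ _
    (trans (length-map _ β) (trans (length-↭-oneTo β↭) (sym (trans (length-map _ α) (length-↭-oneTo α↭)))))
    (proj₂ split-left)
  v′≡v : v′ ≡ v
  v′≡v = ≤-antisym (map-hatα-pivot-≤ β↭ α↭ 1≤l (sym (proj₁ split-right)))
                   (map-hatα-pivot-≤ α↭ β↭ 1≤l (proj₁ split-right))
  hatσ′≡hatσ : hatσ v′ L′ ≡ hatσ v L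
  hatσ′≡hatσ = cong₂ hatσ v′≡v (trans (length-↭-oneTo β↭) (sym (length-↭-oneTo α↭)))
  map-hatσ-injective : Injective _≡_ _≡_ (map (hatσ v L))
  map-hatσ-injective = map-injective (hatσ-injective v L (subst (1 ≤_) (sym (length-↭-oneTo α↭)) 1≤l))
  A′≡A : take a τ ≡ take a σ
  A′≡A = map-hatσ-injective
    (subst (λ f → map f (take a τ) ≡ map (hatσ v L) (take a σ)) hatσ′≡hatσ (proj₁ split-left))
  D′≡D : drop (suc a) τ ≡ drop (suc a) σ
  D′≡D = map-hatσ-injective
    (subst (λ f → map f (drop (suc a) τ) ≡ map (hatσ v L) (drop (suc a) σ)) hatσ′≡hatσ
           (proj₂ split-right))
  β≡α : β ≡ α
  β≡α = map-injective (hatα-injective v 1≤v)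
    (subst (λ u → map (hatα u) β ≡ map (hatα v) α) v′≡v (proj₁ split-right))
  τ≡σ : τ ≡ σ
  τ≡σ = begin
    τ                               ≡⟨ take-at-drop a τ a<τ ⟨
    take a τ ++ v′ ∷ drop (suc a) τ ≡⟨ cong₂ _++_ A′≡A (cong₂ _∷_ v′≡v D′≡D) ⟩
    take a σ ++ v ∷ drop (suc a) σ  ≡⟨ take-at-drop a σ a<σ ⟩
    σ                               ∎
    where open ≡-Reasoning

-- Of the hypotheses only [a+1, m] ⊆ RLmax σ and a+1 ∉ Stp σ are ever needed.
Hyp⇒IsRLmax : ∀ {m l σ α a} → Hyp m l σ α a → ∀ i → suc a ≤ i → i ≤ m → IsRLmax σ i
Hyp⇒IsRLmax (_ , (_ , _ , _ , RLmax⇔) , _) i a<i i≤m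
  with _ , refl , isRLmax ← proj₂ (RLmax⇔ (+ i)) (inj₂ (inj₂ (+≤+ a<i , +≤+ i≤m))) = isRLmax

Hyp⇒¬IsStep : ∀ {m l σ α a} → Hyp m l σ α a → ¬ IsStep σ (suc a)
Hyp⇒¬IsStep (_ , _ , _ , Stp⊆a) step = 1+n≢n (Stp⊆a _ step)

Hyp⇒pivot<length : ∀ {m l} (σ α : List ℕ) a → σ ↭ oneTo m → Hyp m l σ α a → suc a ≤ length σ
Hyp⇒pivot<length σ α a σ↭ hyp = subst (suc a ≤_) (sym (length-↭-oneTo σ↭)) (proj₁ hyp)

Hyp⇒inflate-isMaximalIntervalSeg : ∀ {m l} (σ α : List ℕ) a → σ ↭ oneTo m → α ↭ oneTo l → 1 ≤ l →
  Hyp m l σ α a → IsMaximalIntervalSeg (inflate σ α a) (a + 1) (a + l)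
Hyp⇒inflate-isMaximalIntervalSeg σ α a σ↭ α↭ 1≤l hyp =
  inflate-isMaximalIntervalSeg σ α a α↭ 1≤l a<σ (at-↭-oneTo-positive σ↭ a<σ)
    (drop-below-pivot σ a
      (λ i a<i i≤σ → Hyp⇒IsRLmax {σ = σ} {α} hyp i a<i (subst (i ≤_) (length-↭-oneTo σ↭) i≤σ))
      (Hyp⇒¬IsStep {σ = σ} {α} hyp))
  where a<σ = Hyp⇒pivot<length σ α a σ↭ hyp

lemma8 : {m l : ℕ} (σ : S m) (α : S l) (a : ℕ) → 1 ≤ m → 1 ≤ l →
    Hyp m l (proj₁ σ) (proj₁ α) a →
    -- a+l is the largest k with {σ'_{a+1},…,σ'_k} an interval
    (SegIsInterval (inflate (proj₁ σ) (proj₁ α) a) (a + 1) (a + l) ×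
     (∀ k → a + l < k → k ≤ length (inflate (proj₁ σ) (proj₁ α) a) →
        ¬ SegIsInterval (inflate (proj₁ σ) (proj₁ α) a) (a + 1) k)) ×
    -- uniqueness: σ and α are determined by σ' and a
    ({m' l' : ℕ} (τ : S m') (β : S l') → 1 ≤ m' → 1 ≤ l' →
      Hyp m' l' (proj₁ τ) (proj₁ β) a →
      inflate (proj₁ τ) (proj₁ β) a ≡ inflate (proj₁ σ) (proj₁ α) a →
      (proj₁ τ ≡ proj₁ σ) × (proj₁ β ≡ proj₁ α))
lemma8 {l = l} (σ , σ↭) (α , α↭) a _ 1≤l hyp = maximal , unique
  where
  maximal : IsMaximalIntervalSeg (inflate σ α a) (a + 1) (a + l)
  maximal = Hyp⇒inflate-isMaximalIntervalSeg σ α a σ↭ α↭ 1≤l hyp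
  a<σ : suc a ≤ length σ
  a<σ = Hyp⇒pivot<length σ α a σ↭ hyp
  unique : ∀ {m′ l′} (τ : S m′) (β : S l′) → 1 ≤ m′ → 1 ≤ l′ →
    Hyp m′ l′ (proj₁ τ) (proj₁ β) a → inflate (proj₁ τ) (proj₁ β) a ≡ inflate σ α a →
    proj₁ τ ≡ σ × proj₁ β ≡ α
  unique {l′ = l′} (τ , τ↭) (β , β↭) _ 1≤l′ hyp′ eq =
    inflate-injective σ τ α β a α↭ (subst (λ n → β ↭ oneTo n) l′≡l β↭) 1≤l a<σ a<τ
      (at-↭-oneTo-positive σ↭ a<σ) eq
    where
    a<τ : suc a ≤ length τ
    a<τ = Hyp⇒pivot<length τ β a τ↭ hyp′
    l′≡l : l′ ≡ l
    l′≡l = +-cancelˡ-≡ a _ _ (IsMaximalIntervalSeg-unique {inflate σ α a}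
      (subst (λ w → a + l′ ≤ length w) eq (a+l≤length-inflate τ β a β↭ (<⇒≤ a<τ)))
      (a+l≤length-inflate σ α a α↭ (<⇒≤ a<σ))
      (subst (λ w → IsMaximalIntervalSeg w (a + 1) (a + l′)) eq
        (Hyp⇒inflate-isMaximalIntervalSeg τ β a τ↭ β↭ 1≤l′ hyp′))
      maximal)
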